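{- Let $G\in\mathcal E$ be a Left-end with $\operatorname{rank}(G)=k>0$. Then $G\geq_{\mathcal E} M_n$ for every integer $n\geq k$.
   Context: All games are short (finite) two-player partizan games between Left and Right, identified with their game trees: a game is $G=\{G^{\mathcal L}\mid G^{\mathcal R}\}$ with finite sets of Left and Right options. Followers of $G$ are $G$, its options, their options, etc. The rank of $G$ is the height of its game tree (the maximum length of a sequence of successive moves starting from $G$); $\mathbf 0=\{\;\mid\;\}$ has rank $0$. Disjunctive sum: $G+H=\{G^{\mathcal L}+H,\,G+H^{\mathcal L}\mid G^{\mathcal R}+H,\,G+H^{\mathcal R}\}$. Misère play: a player with no move on their turn wins. $o_L(G)=\mathrm L$ if $G^{\mathcal L}=\emptyset$, else $\max_{G^L}o_R(G^L)$; $o_R(G)=\mathrm R$ if $G^{\mathcal R}=\emptyset$, else $\min_{G^R}o_L(G^R)$; $\mathrm L>\mathrm R$. The outcome $o(G)$ is the pair $(o_L(G),o_R(G))$, named $\mathscr L,\mathscr N,\mathscr P,\mathscr R$ for $(\mathrm L,\mathrm L),(\mathrm L,\mathrm R),(\mathrm R,\mathrm L),(\mathrm R,\mathrm R)$, ordered componentwise. A Left-end is a game with no Left option; a dead Left-end is a game all of whose followers are Left-ends; similarly for Right. A game is dead-ending if every follower that is a Left-end (resp. Right-end) is a dead Left-end (resp. dead Right-end); $\mathcal E$ is the class of dead-ending games. $G\geq_{\mathcal E}H$ means $o(G+X)\geq o(H+X)$ for all $X\in\mathcal E$. Perfect murders: $M_0=\mathbf 0$, $M_n=\{\;\mid\mathbf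 0,M_{n-1}\}$ for $n>0$. -}

module Defs where

open import Data.Nat using (ℕ; zero; suc; _⊔_)
open import Data.List using (List; []; _∷_)
open import Data.List.Membership.Propositional using (_∈_)
open import Data.Product using (_×_; _,_)
open import Relation.Binary.PropositionalEquality using (_≡_)

-- Short partizan games as finite game trees: Left options, Right options.
-- (Finite sets of options are represented by lists; outcomes do not depend
-- on order or repetitions.)
data Game : Set where
  mk : List Game → List Game → Game

LeftOpts : Game → List Game
LeftOpts (mk l r) = l

RightOpts : Game → List Game
RightOpts (mk l r) = r

𝟎 : Game
𝟎 = mk [] []

mutual
  infixl 6 _+ᴳ_
  _+ᴳ_ : Game → Game → Game
  mk gl gr +ᴳ mk hl hr =
    mk (addL gl (mk hl hr) ++' addR (mk gl gr) hl)
       (addL gr (mk hl hr) ++' addR (mk gl gr) hr)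

  addL : List Game → Game → List Game
  addL [] h = []
  addL (g ∷ gs) h = (g +ᴳ h) ∷ addL gs h

  addR : Game → List Game → List Game
  addR g [] = []
  addR g (h ∷ hs) = (g +ᴳ h) ∷ addR g hs

  _++'_ : List Game → List Game → List Game
  [] ++' ys = ys
  (x ∷ xs) ++' ys = x ∷ (xs ++' ys)

mutual
  rank : Game → ℕ
  rank (mk l r) = rankList l ⊔ rankList r

  rankList : List Game → ℕ
  rankList [] = 0
  rankList (g ∷ gs) = suc (rank g) ⊔ rankList gs

data Result : Set where
  Lwin Rwin : Result

maxR : Result → Result → Result
maxR Lwin _ = Lwin
maxR Rwin y = y

minR : Result → Result → Result
minR Rwin _ = Rwin
minR Lwin y = y

data _≤ᴿ_ : Result → Result → Set where
  R≤ : ∀ {x} → Rwin ≤ᴿ x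
  L≤L : Lwin ≤ᴿ Lwin

mutual
  -- outcome when Left moves first (misère: no move ⇒ that player wins)
  oL : Game → Result
  oL (mk [] r) = Lwin
  oL (mk (x ∷ xs) r) = maxOR x xs

  maxOR : Game → List Game → Result
  maxOR x [] = oR x
  maxOR x (y ∷ ys) = maxR (oR x) (maxOR y ys)

  oR : Game → Result
  oR (mk l []) = Rwin
  oR (mk l (x ∷ xs)) = minOL x xs

  minOL : Game → List Game → Result
  minOL x [] = oL x
  minOL x (y ∷ ys) = minR (oL x) (minOL y ys)

_≤ₒ_ : Game → Game → Set
G ≤ₒ H = (oL G ≤ᴿ oL H) × (oR G ≤ᴿ oR H)

data Follower : Game → Game → Set where
  self  : ∀ {G} → Follower G G
  viaL  : ∀ {G F} {H} → H ∈ LeftOpts G → Follower H F → Follower G F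
  viaR  : ∀ {G F} {H} → H ∈ RightOpts G → Follower H F → Follower G F

IsLeftEnd : Game → Set
IsLeftEnd G = LeftOpts G ≡ []

IsRightEnd : Game → Set
IsRightEnd G = RightOpts G ≡ []

DeadLeftEnd : Game → Set
DeadLeftEnd G = ∀ F → Follower G F → IsLeftEnd F

DeadRightEnd : Game → Set
DeadRightEnd G = ∀ F → Follower G F → IsRightEnd F

DeadEnding : Game → Set
DeadEnding G = ∀ F → Follower G F →
  (IsLeftEnd F → DeadLeftEnd F) × (IsRightEnd F → DeadRightEnd F)

_≥𝓔_ : Game → Game → Set
G ≥𝓔 H = ∀ X → DeadEnding X → (H +ᴳ X) ≤ₒ (G +ᴳ X)

M : ℕ → Game
M zero = 𝟎
M (suc n) = mk [] (𝟎 ∷ M n ∷ [])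

module Submission where

-- The core lemma (murder-dominated) shows that for every dead Left-end
-- H having a Right option and every m ≥ rank H, each outcome in which Left
-- wins M_m + X is also won by Left in H + X, for ALL games X.  It is proved by
-- simultaneous induction on rank H + rank X, playing through the sum:
--   * Left's moves in M_m + X are all in X, and she copies them in H + X;
--   * Right's moves in X are answered inductively;  Right's move to H' in H is
--     matched by Right's move in M_m to 𝟎 (when H' = 𝟎, the only dead
--     Left-end without Right options) or to M_{m-1} (otherwise, since then
--     rank H' ≤ m - 1 and H' again has a Right option).

open import Defs
open import Data.Nat using (ℕ; zero; suc; _+_; _<_; _≤_; s≤s; s≤s⁻¹)
open import Data.Nat.Properties
  using (≤-trans; ≤-refl; m≤m⊔n; m≤n⊔m; +-monoʳ-<; +-monoˡ-<; <-≤-trans)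
open import Data.List using (List; []; _∷_)
open import Data.List.Relation.Unary.Any using (here; there)
open import Data.List.Membership.Propositional using (_∈_)
open import Data.Product using (_×_; _,_; proj₁; ∃)
open import Data.Sum using (_⊎_; inj₁; inj₂)
open import Relation.Binary.PropositionalEquality using (_≡_; refl)

∈-++'ˡ : ∀ {y} {xs ys : List Game} → y ∈ xs → y ∈ (xs ++' ys)
∈-++'ˡ (here p)  = here p
∈-++'ˡ (there p) = there (∈-++'ˡ p)

∈-++'ʳ : ∀ {y} (xs : List Game) {ys} → y ∈ ys → y ∈ (xs ++' ys)
∈-++'ʳ []       p = p
∈-++'ʳ (x ∷ xs) p = there (∈-++'ʳ xs p)

∈-++'-split : ∀ {y} (xs : List Game) {ys} → y ∈ (xs ++' ys) → y ∈ xs ⊎ y ∈ ys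
∈-++'-split []       p         = inj₂ p
∈-++'-split (x ∷ xs) (here p)  = inj₁ (here p)
∈-++'-split (x ∷ xs) (there p) with ∈-++'-split xs p
... | inj₁ q = inj₁ (there q)
... | inj₂ q = inj₂ q

∈-addL : ∀ {x xs h} → x ∈ xs → (x +ᴳ h) ∈ addL xs h
∈-addL (here refl) = here refl
∈-addL (there p)   = there (∈-addL p)

∈-addR : ∀ {x xs g} → x ∈ xs → (g +ᴳ x) ∈ addR g xs
∈-addR (here refl) = here refl
∈-addR (there p)   = there (∈-addR p)

addL-∈⁻ : ∀ {y h} (xs : List Game) → y ∈ addL xs h → ∃ λ x → x ∈ xs × y ≡ x +ᴳ h
addL-∈⁻ (x ∷ xs) (here p)  = x , here refl , p
addL-∈⁻ (x ∷ xs) (there p) with addL-∈⁻ xs p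
... | z , z∈ , eq = z , there z∈ , eq

addR-∈⁻ : ∀ {y g} (xs : List Game) → y ∈ addR g xs → ∃ λ x → x ∈ xs × y ≡ g +ᴳ x
addR-∈⁻ (x ∷ xs) (here p)  = x , here refl , p
addR-∈⁻ (x ∷ xs) (there p) with addR-∈⁻ xs p
... | z , z∈ , eq = z , there z∈ , eq

leftMoveIn₂ : ∀ G X {x} → x ∈ LeftOpts X → (G +ᴳ x) ∈ LeftOpts (G +ᴳ X)
leftMoveIn₂ (mk gl gr) (mk xl xr) p = ∈-++'ʳ (addL gl (mk xl xr)) (∈-addR p)

rightMoveIn₁ : ∀ G X {g} → g ∈ RightOpts G → (g +ᴳ X) ∈ RightOpts (G +ᴳ X)
rightMoveIn₁ (mk gl gr) (mk xl xr) p = ∈-++'ˡ (∈-addL p)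

rightMoveIn₂ : ∀ G X {x} → x ∈ RightOpts X → (G +ᴳ x) ∈ RightOpts (G +ᴳ X)
rightMoveIn₂ (mk gl gr) (mk xl xr) p = ∈-++'ʳ (addL gr (mk xl xr)) (∈-addR p)

leftMove⁻ : ∀ G X {y} → y ∈ LeftOpts (G +ᴳ X) →
  (∃ λ g → g ∈ LeftOpts G × y ≡ g +ᴳ X) ⊎ (∃ λ x → x ∈ LeftOpts X × y ≡ G +ᴳ x)
leftMove⁻ (mk gl gr) (mk xl xr) p with ∈-++'-split (addL gl (mk xl xr)) p
... | inj₁ q = inj₁ (addL-∈⁻ gl q)
... | inj₂ q = inj₂ (addR-∈⁻ xl q)

rightMove⁻ : ∀ G X {y} → y ∈ RightOpts (G +ᴳ X) →
  (∃ λ g → g ∈ RightOpts G × y ≡ g +ᴳ X) ⊎ (∃ λ x → x ∈ RightOpts X × y ≡ G +ᴳ x)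
rightMove⁻ (mk gl gr) (mk xl xr) p with ∈-++'-split (addL gr (mk xl xr)) p
... | inj₁ q = inj₁ (addL-∈⁻ gr q)
... | inj₂ q = inj₂ (addR-∈⁻ xr q)

leftEnd-+ : ∀ G X → IsLeftEnd G → IsLeftEnd X → IsLeftEnd (G +ᴳ X)
leftEnd-+ (mk [] gr) (mk [] xr) refl refl = refl

leftEnd-intro : ∀ X → (∀ {x} → x ∈ LeftOpts X → IsLeftEnd X) → IsLeftEnd X
leftEnd-intro (mk []       r) h = refl
leftEnd-intro (mk (x ∷ xs) r) h = h (here refl)

∉-leftEnd : ∀ G {x} → IsLeftEnd G → x ∈ LeftOpts G → ∀ {A : Set} → A
∉-leftEnd (mk [] r) refl ()

maxOR-intro : ∀ {y} x xs → y ∈ (x ∷ xs) → oR y ≡ Lwin → maxOR x xs ≡ Lwin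
maxOR-intro x []       (here refl) e = e
maxOR-intro x (z ∷ zs) (here refl) e rewrite e = refl
maxOR-intro x (z ∷ zs) (there p)   e with oR x
... | Lwin = refl
... | Rwin = maxOR-intro z zs p e

maxOR-elim : ∀ x xs → maxOR x xs ≡ Lwin → ∃ λ y → y ∈ (x ∷ xs) × oR y ≡ Lwin
maxOR-elim x []       e = x , here refl , e
maxOR-elim x (z ∷ zs) e with oR x in eq
... | Lwin = x , here refl , eq
... | Rwin with maxOR-elim z zs e
...   | y , y∈ , e′ = y , there y∈ , e′

minOL-intro : ∀ x xs → (∀ {z} → z ∈ (x ∷ xs) → oL z ≡ Lwin) → minOL x xs ≡ Lwin
minOL-intro x []       h = h (here refl)
minOL-intro x (z ∷ zs) h rewrite h (here refl) = minOL-intro z zs (λ p → h (there p))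

minOL-elim : ∀ x xs → minOL x xs ≡ Lwin → ∀ {z} → z ∈ (x ∷ xs) → oL z ≡ Lwin
minOL-elim x []       e (here refl) = e
minOL-elim x (y ∷ ys) e p with oL x in eq
minOL-elim x (y ∷ ys) e (here refl) | Lwin = eq
minOL-elim x (y ∷ ys) e (there p)   | Lwin = minOL-elim y ys e p

oL-byMove : ∀ G {y} → y ∈ LeftOpts G → oR y ≡ Lwin → oL G ≡ Lwin
oL-byMove (mk (x ∷ xs) r) p e = maxOR-intro x xs p e

oL-leftEnd : ∀ G → IsLeftEnd G → oL G ≡ Lwin
oL-leftEnd (mk [] r) refl = refl

oL-elim : ∀ G → oL G ≡ Lwin →
  IsLeftEnd G ⊎ (∃ λ y → y ∈ LeftOpts G × oR y ≡ Lwin)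
oL-elim (mk []       r) e = inj₁ refl
oL-elim (mk (x ∷ xs) r) e = inj₂ (maxOR-elim x xs e)

oR-allMoves : ∀ G {y} → y ∈ RightOpts G →
  (∀ {z} → z ∈ RightOpts G → oL z ≡ Lwin) → oR G ≡ Lwin
oR-allMoves (mk l (x ∷ xs)) p h = minOL-intro x xs h

oR-elim : ∀ G → oR G ≡ Lwin → ∀ {z} → z ∈ RightOpts G → oL z ≡ Lwin
oR-elim (mk l (x ∷ xs)) e p = minOL-elim x xs e p

-- Outcomes are two-valued, so comparing them amounts to "Left wins" transfer.
≤ᴿ-fromLwin : ∀ {a b} → (a ≡ Lwin → b ≡ Lwin) → a ≤ᴿ b
≤ᴿ-fromLwin {Rwin} h = R≤
≤ᴿ-fromLwin {Lwin} h rewrite h refl = L≤L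

rankList-∈ : ∀ {x} (xs : List Game) → x ∈ xs → suc (rank x) ≤ rankList xs
rankList-∈ (y ∷ ys) (here refl) = m≤m⊔n (suc (rank y)) (rankList ys)
rankList-∈ (y ∷ ys) (there p)   =
  ≤-trans (rankList-∈ ys p) (m≤n⊔m (suc (rank y)) (rankList ys))

rank-leftOpt : ∀ G {x} → x ∈ LeftOpts G → rank x < rank G
rank-leftOpt (mk l r) p = ≤-trans (rankList-∈ l p) (m≤m⊔n (rankList l) (rankList r))

rank-rightOpt : ∀ G {x} → x ∈ RightOpts G → rank x < rank G
rank-rightOpt (mk l r) p = ≤-trans (rankList-∈ r p) (m≤n⊔m (rankList l) (rankList r))

HasRightOption : Game → Set
HasRightOption H = ∃ λ h → h ∈ RightOpts H

murder-leftEnd : ∀ m → IsLeftEnd (M m)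
murder-leftEnd zero    = refl
murder-leftEnd (suc m) = refl

leftEnd-hasRightOption : ∀ G → IsLeftEnd G → 0 < rank G → HasRightOption G
leftEnd-hasRightOption (mk [] (h ∷ hs)) refl pos = h , here refl

mutual
  murder-dominatedˡ : ∀ b H m X → rank H + rank X < b →
    DeadLeftEnd H → HasRightOption H → rank H ≤ m →
    oL (M m +ᴳ X) ≡ Lwin → oL (H +ᴳ X) ≡ Lwin
  murder-dominatedˡ (suc b) H m X (s≤s bound) dead hasR rk win
    with oL-elim (M m +ᴳ X) win
  ... | inj₁ noMove =
    oL-leftEnd (H +ᴳ X) (leftEnd-+ H X (dead H self)
      (leftEnd-intro X (λ p → ∉-leftEnd (M m +ᴳ X) noMove (leftMoveIn₂ (M m) X p))))
  ... | inj₂ (y , y∈ , winY) with leftMove⁻ (M m) X y∈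
  ...   | inj₁ (g , g∈ , _) = ∉-leftEnd (M m) (murder-leftEnd m) g∈
  ...   | inj₂ (x , x∈ , refl) =
    oL-byMove (H +ᴳ X) (leftMoveIn₂ H X x∈)
      (murder-dominatedʳ b H m x
        (<-≤-trans (+-monoʳ-< (rank H) (rank-leftOpt X x∈)) bound)
        dead hasR rk winY)

  murder-dominatedʳ : ∀ b H m X → rank H + rank X < b →
    DeadLeftEnd H → HasRightOption H → rank H ≤ m →
    oR (M m +ᴳ X) ≡ Lwin → oR (H +ᴳ X) ≡ Lwin
  murder-dominatedʳ (suc b) H zero X _ _ (h , h∈) rk _
    with ≤-trans (rank-rightOpt H h∈) rk
  ... | ()
  murder-dominatedʳ (suc b) H (suc m) X (s≤s bound) dead (h , h∈) rk win =
    oR-allMoves (H +ᴳ X) (rightMoveIn₁ H X h∈) answer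
    where
    winAfter : ∀ {z} → z ∈ RightOpts (M (suc m) +ᴳ X) → oL z ≡ Lwin
    winAfter = oR-elim (M (suc m) +ᴳ X) win

    answer : ∀ {z} → z ∈ RightOpts (H +ᴳ X) → oL z ≡ Lwin
    answer z∈ with rightMove⁻ H X z∈
    -- Right moves in X: Right makes the same move in M_{m+1} + X.
    ... | inj₂ (x , x∈ , refl) =
      murder-dominatedˡ b H (suc m) x
        (<-≤-trans (+-monoʳ-< (rank H) (rank-rightOpt X x∈)) bound)
        dead (h , h∈) rk (winAfter (rightMoveIn₂ (M (suc m)) X x∈))
    -- Right moves to a dead Left-end without Right options, i.e. to 𝟎:
    -- compare with Right's move M_{m+1} → 𝟎.
    ... | inj₁ (mk l′ [] , h′∈ , refl) with dead _ (viaR h′∈ self)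
    ...   | refl = winAfter (rightMoveIn₁ (M (suc m)) X (here refl))
    -- Right moves to H′ with a Right option: compare with M_{m+1} → M_m.
    answer z∈ | inj₁ (mk l′ (k ∷ ks) , h′∈ , refl) =
      murder-dominatedˡ b (mk l′ (k ∷ ks)) m X
        (<-≤-trans (+-monoˡ-< (rank X) (rank-rightOpt H h′∈)) bound)
        (λ F fo → dead F (viaR h′∈ fo)) (k , here refl)
        (s≤s⁻¹ (≤-trans (rank-rightOpt H h′∈) rk))
        (winAfter (rightMoveIn₁ (M (suc m)) X (there (here refl))))

mainTheorem2 : (G : Game) → DeadEnding G → IsLeftEnd G → 0 < rank G →
    (n : ℕ) → rank G ≤ n → G ≥𝓔 M n
mainTheorem2 G deadEnding leftEnd pos n rk X _ =
  ≤ᴿ-fromLwin (murder-dominatedˡ bound G n X ≤-refl dead hasR rk) ,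
  ≤ᴿ-fromLwin (murder-dominatedʳ bound G n X ≤-refl dead hasR rk)
  where
  bound = suc (rank G + rank X)
  dead : DeadLeftEnd G
  dead = proj₁ (deadEnding G self) leftEnd
  hasR : HasRightOption G
  hasR = leftEnd-hasRightOption G leftEnd pos
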